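{- Let $n,m\ge3$ be odd integers and let $S$ and $T$ be 2-partitions of $\mathbb{Z}_n^*$ and $\mathbb{Z}_m^*$ respectively. Then every product $W_{ST}$ of $S$ and $T$ is a 2-partition of $\mathbb{Z}_{mn}^*$.
   Context: $\mathbb{Z}_k^*=\mathbb{Z}_k\setminus\{0\}$; a 2-partition of $\mathbb{Z}_k^*$ is a partition of it into unordered pairs. Product: let $n=2q+1$, $m=2p+1$. Let $\tilde S$ be any set of ordered pairs obtained by ordering each pair of $S$ in either way. Let $\bar T=\{(r_j,t_j)\}_{j=1}^p$ be obtained by ordering each pair of $T$ so that $\bigcup_j\{\pm r_j\}=\mathbb{Z}_m^*$, and $\bar T'=\{(-r_j,-t_j)\}_{j=1}^p$. A product $W_{ST}$ is the collection of $2pq+p+q$ unordered pairs $\{nr+x,\ nt+y\}$ (mod $nm$, with $x,y$ represented in $\{0,\dots,n-1\}$) of two types: (i) one pair for each $(r,t)\in\bar T\cup\bar T'\cup\{(0,0)\}$ and each $(x,y)\in\tilde S$; (ii) one pair for each $(r,t)\in\bar T$ with $x=y=0$. -}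

module Defs where

open import Data.Nat using (ℕ; zero; suc; _+_; _*_; _∸_; _%_)
open import Data.Product using (_×_; _,_)
open import Data.Sum using (_⊎_)
open import Data.List using (List; []; _∷_; map; concatMap; upTo; _++_; cartesianProductWith)
open import Data.List.Relation.Binary.Pointwise using (Pointwise)
open import Data.List.Relation.Binary.Permutation.Propositional using (_↭_)
open import Relation.Binary.PropositionalEquality using (_≡_)

-- Elements of ℤ_k are represented by their canonical residues 0,…,k-1 in ℕ.
-- Reduction mod k (k = 0 never occurs in use; defined to avoid NonZero instances).
_mod_ : ℕ → ℕ → ℕ
a mod zero    = a
a mod (suc k) = a % suc k

neg : ℕ → ℕ → ℕ
neg k r = (k ∸ r) mod k

Zstar : ℕ → List ℕ
Zstar k = map suc (upTo (k ∸ 1))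

entries : List (ℕ × ℕ) → List ℕ
entries = concatMap (λ { (a , b) → a ∷ b ∷ [] })

-- A 2-partition of ℤ_k^*: a collection of pairs (each unordered pair stored as
-- an ordered pair in either order) such that every element of ℤ_k^* occurs in
-- exactly one pair, exactly once (entries form a permutation of ℤ_k^*).
Is2Partition : ℕ → List (ℕ × ℕ) → Set
Is2Partition k P = entries P ↭ Zstar k

-- Q is obtained from P by ordering each pair of P in one of the two ways.
swap : ℕ × ℕ → ℕ × ℕ
swap (a , b) = (b , a)

Reorders : List (ℕ × ℕ) → List (ℕ × ℕ) → Set
Reorders P Q = Pointwise (λ u v → v ≡ u ⊎ v ≡ swap u) P Q

-- Condition on T̄ = {(r_j,t_j)}: ⋃_j {± r_j} = ℤ_m^*  (as a multiset union, i.e.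
-- the r_j and -r_j together list each element of ℤ_m^* exactly once).
firsts : List (ℕ × ℕ) → List ℕ
firsts = map (λ { (r , t) → r })

GoodOrder : ℕ → List (ℕ × ℕ) → Set
GoodOrder m Tbar = (firsts Tbar ++ map (neg m) (firsts Tbar)) ↭ Zstar m

negPairs : ℕ → List (ℕ × ℕ) → List (ℕ × ℕ)
negPairs m = map (λ { (r , t) → (neg m r , neg m t) })

prodPair : ℕ → ℕ → (ℕ × ℕ) → (ℕ × ℕ) → ℕ × ℕ
prodPair n m (r , t) (x , y) = ((n * r + x) mod (n * m) , (n * t + y) mod (n * m))

-- The product W_ST built from S̃ and T̄:
-- type (i): (r,t) ∈ T̄ ∪ T̄' ∪ {(0,0)}, (x,y) ∈ S̃;  type (ii): (r,t) ∈ T̄, x = y = 0.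
product : ℕ → ℕ → List (ℕ × ℕ) → List (ℕ × ℕ) → List (ℕ × ℕ)
product n m Stilde Tbar =
  cartesianProductWith (prodPair n m) (Tbar ++ negPairs m Tbar ++ ((0 , 0) ∷ [])) Stilde
  ++ map (λ rt → prodPair n m rt (0 , 0)) Tbar

-- Every element of ℤ_nm is n r + x for exactly one r ∈ ℤ_m and x ∈ ℤ_n.
-- The first coordinates of T̄ ∪ T̄' ∪ {(0,0)} run through ℤ_m exactly once by the choice of T̄,
-- and so do the second coordinates, because the t_j are, as a multiset, exactly the -r_j.
-- Hence the pairs of type (i) cover every n r + x with x ≠ 0 exactly once, and the pairs of
-- type (ii) cover every n t with t ≠ 0 exactly once.
module Submission where

open import Defs
open import Data.Nat using (ℕ; zero; suc; _≤_; _<_; _+_; _*_; _∸_; _%_; s≤s)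
open import Data.Nat.Properties
  using (*-zeroʳ; *-suc; +-comm; +-∸-assoc; m∸n≤m; m∸[m∸n]≡n; <⇒≤)
open import Data.Nat.DivMod using (m<n⇒m%n≡m; n%n≡0)
open import Data.Product using (_×_; _,_; proj₁; proj₂; zip′)
import Data.Product as ×
open import Data.Sum using (inj₁; inj₂)
open import Data.List
  using (List; []; _∷_; [_]; map; concatMap; upTo; applyUpTo; _++_; cartesianProductWith)
open import Data.List.Properties
  using (map-++; map-∘; map-id; map-id-local; map-upTo; upTo-∷ʳ; ++-assoc; ++-identityʳ;
         map-cong; concatMap-++; concatMap-map; concatMap-pure; concatMap-cong; map-concatMap)
open import Data.List.Relation.Unary.All using (tabulate)
open import Data.List.Membership.Propositional using (_∈_)
open import Data.List.Membership.Propositional.Properties using (∈-upTo⁻; ∈-map⁻; ∈-++⁺ˡ)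
open import Data.List.Relation.Binary.Pointwise using ([]; _∷_)
open import Data.List.Relation.Binary.Permutation.Propositional
  using (_↭_; ↭-refl; ↭-sym; ↭-trans; ↭-reflexive; ↭-prep; ↭-swap; module PermutationReasoning)
import Data.List.Relation.Binary.Permutation.Propositional as ↭
open import Data.List.Relation.Binary.Permutation.Propositional.Properties
  using (++⁺ˡ; ++⁺; ++-comm; shifts; drop-∷; map⁺; ∈-resp-↭)
open import Relation.Binary.PropositionalEquality
  using (_≡_; refl; sym; trans; cong; cong₂; module ≡-Reasoning)
open import Function using (_∘_; flip)

private
  variable
    A B C : Set

concatMap⁺ : (f : A → List B) {xs ys : List A} → xs ↭ ys → concatMap f xs ↭ concatMap f ys
concatMap⁺ f ↭.refl         = ↭-refl
concatMap⁺ f (↭.prep x p)   = ++⁺ˡ (f x) (concatMap⁺ f p)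
concatMap⁺ f (↭.swap x y p) =
  ↭-trans (shifts (f x) (f y)) (++⁺ˡ (f y) (++⁺ˡ (f x) (concatMap⁺ f p)))
concatMap⁺ f (↭.trans p q)  = ↭-trans (concatMap⁺ f p) (concatMap⁺ f q)

concatMap-cong-↭ : {f g : A → List B} → (∀ a → f a ↭ g a) →
                   (xs : List A) → concatMap f xs ↭ concatMap g xs
concatMap-cong-↭ f↭g []       = ↭-refl
concatMap-cong-↭ f↭g (x ∷ xs) = ++⁺ (f↭g x) (concatMap-cong-↭ f↭g xs)

concatMap-concatMap : (f : B → List C) (g : A → List B) (xs : List A) →
                      concatMap f (concatMap g xs) ≡ concatMap (concatMap f ∘ g) xs
concatMap-concatMap f g []       = refl
concatMap-concatMap f g (x ∷ xs) =
  trans (concatMap-++ f (g x) _) (cong (concatMap f (g x) ++_) (concatMap-concatMap f g xs))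

concatMap-[] : (xs : List A) → concatMap {B = B} (λ _ → []) xs ≡ []
concatMap-[] []       = refl
concatMap-[] (_ ∷ xs) = concatMap-[] xs

concatMap-∷-↭ : (g : A → B) (h : A → List B) (xs : List A) →
                concatMap (λ a → g a ∷ h a) xs ↭ map g xs ++ concatMap h xs
concatMap-∷-↭ g h []       = ↭-refl
concatMap-∷-↭ g h (x ∷ xs) =
  ↭-prep (g x) (↭-trans (++⁺ˡ (h x) (concatMap-∷-↭ g h xs)) (shifts (h x) (map g xs)))

concatMap-pair-↭ : (g h : A → B) (xs : List A) →
                   concatMap (λ a → g a ∷ h a ∷ []) xs ↭ map g xs ++ map h xs
concatMap-pair-↭ g h xs = ↭-trans (concatMap-∷-↭ g (λ a → [ h a ]) xs)
  (++⁺ˡ (map g xs) (↭-reflexive (trans (sym (concatMap-map [_] h xs)) (concatMap-pure (map h xs)))))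

concatMap-map-transpose : (f : A → B → C) (xs : List A) (ys : List B) →
  concatMap (λ x → map (f x) ys) xs ↭ concatMap (λ y → map (flip f y) xs) ys
concatMap-map-transpose f []       ys = ↭-reflexive (sym (concatMap-[] ys))
concatMap-map-transpose f (x ∷ xs) ys =
  ↭-trans (++⁺ˡ (map (f x) ys) (concatMap-map-transpose f xs ys))
          (↭-sym (concatMap-∷-↭ (f x) (λ y → map (flip f y) xs) ys))

cartesianProductWith-concatMap : (f : A → B → C) (xs : List A) (ys : List B) →
  cartesianProductWith f xs ys ≡ concatMap (λ x → map (f x) ys) xs
cartesianProductWith-concatMap f []       ys = refl
cartesianProductWith-concatMap f (x ∷ xs) ys =
  cong (map (f x) ys ++_) (cartesianProductWith-concatMap f xs ys)

↭-cancelˡ : (xs : List A) {ys zs : List A} → xs ++ ys ↭ xs ++ zs → ys ↭ zs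
↭-cancelˡ []       p = p
↭-cancelˡ (x ∷ xs) p = ↭-cancelˡ xs (drop-∷ p)

seconds : List (ℕ × ℕ) → List ℕ
seconds = map proj₂

entries-unzip : (xs : List (ℕ × ℕ)) → entries xs ↭ firsts xs ++ seconds xs
entries-unzip = concatMap-pair-↭ proj₁ proj₂

entries-map-× : (g h : A → ℕ) (xs : List (A × A)) →
  entries (map (×.map g h) xs) ↭ map g (map proj₁ xs) ++ map h (map proj₂ xs)
entries-map-× g h xs = begin
  entries (map (×.map g h) xs)                       ≡⟨ concatMap-map _ (×.map g h) xs ⟩
  concatMap (λ p → g (proj₁ p) ∷ h (proj₂ p) ∷ []) xs ↭⟨ concatMap-pair-↭ (g ∘ proj₁) (h ∘ proj₂) xs ⟩
  map (g ∘ proj₁) xs ++ map (h ∘ proj₂) xs           ≡⟨ cong₂ _++_ (map-∘ xs) (map-∘ xs) ⟩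
  map g (map proj₁ xs) ++ map h (map proj₂ xs)       ∎
  where open PermutationReasoning

entries-map-×-diag : (g : ℕ → ℕ) (xs : List (ℕ × ℕ)) → entries (map (×.map g g) xs) ≡ map g (entries xs)
entries-map-×-diag g xs = trans (concatMap-map _ (×.map g g) xs) (sym (map-concatMap g _ xs))

Reorders⇒entries-↭ : {P Q : List (ℕ × ℕ)} → Reorders P Q → entries P ↭ entries Q
Reorders⇒entries-↭ []                = ↭-refl
Reorders⇒entries-↭ (inj₁ refl ∷ P~Q) = ↭-prep _ (↭-prep _ (Reorders⇒entries-↭ P~Q))
Reorders⇒entries-↭ (inj₂ refl ∷ P~Q) = ↭-swap _ _ (Reorders⇒entries-↭ P~Q)

Is2Partition-reorder : ∀ {k P Q} → Is2Partition k P → Reorders P Q → Is2Partition k Q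
Is2Partition-reorder P-part P~Q = ↭-trans (↭-sym (Reorders⇒entries-↭ P~Q)) P-part

entries-cartesianProductWith-zip′ : (f : A → ℕ → ℕ) (L : List (A × A)) (S : List (ℕ × ℕ)) {Z : List A} →
  map proj₁ L ↭ Z → map proj₂ L ↭ Z →
  entries (cartesianProductWith (zip′ f f) L S) ↭ concatMap (λ x → map (flip f x) Z) (entries S)
entries-cartesianProductWith-zip′ f L S {Z} L₁↭Z L₂↭Z = begin
  entries (cartesianProductWith (zip′ f f) L S)
    ≡⟨ cong entries (cartesianProductWith-concatMap (zip′ f f) L S) ⟩
  entries (concatMap (λ a → map (zip′ f f a) S) L)
    ↭⟨ concatMap⁺ _ (concatMap-map-transpose (zip′ f f) L S) ⟩
  entries (concatMap (λ b → map (flip (zip′ f f) b) L) S)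
    ≡⟨ concatMap-concatMap _ (λ b → map (flip (zip′ f f) b) L) S ⟩
  concatMap (λ b → entries (map (flip (zip′ f f) b) L)) S
    ↭⟨ concatMap-cong-↭ column S ⟩
  concatMap (λ b → concatMap row (proj₁ b ∷ proj₂ b ∷ [])) S
    ≡⟨ concatMap-concatMap row _ S ⟨
  concatMap row (entries S) ∎
  where
  open PermutationReasoning
  row : ℕ → List ℕ
  row x = map (flip f x) Z
  column : ((x , y) : ℕ × ℕ) →
           entries (map (flip (zip′ f f) (x , y)) L) ↭ concatMap row (x ∷ y ∷ [])
  column (x , y) = begin
    entries (map (×.map (flip f x) (flip f y)) L)
      ↭⟨ entries-map-× (flip f x) (flip f y) L ⟩
    map (flip f x) (map proj₁ L) ++ map (flip f y) (map proj₂ L)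
      ↭⟨ ++⁺ (map⁺ (flip f x) L₁↭Z) (map⁺ (flip f y) L₂↭Z) ⟩
    row x ++ row y
      ≡⟨ cong (row x ++_) (++-identityʳ (row y)) ⟨
    row x ++ row y ++ [] ∎

-- prodPair n m is definitionally zip′ (fromDigits n m) (fromDigits n m).
fromDigits : ℕ → ℕ → ℕ → ℕ → ℕ
fromDigits n m r x = (n * r + x) mod (n * m)

coset : ℕ → ℕ → ℕ → List ℕ
coset n m x = map (flip (fromDigits n m) x) (upTo m)

mod-small : ∀ {a k} → a < k → a mod k ≡ a
mod-small {k = suc k} a<k = m<n⇒m%n≡m a<k

upTo-+ : ∀ a b → upTo (a + b) ≡ upTo a ++ map (a +_) (upTo b)
upTo-+ zero    b = sym (map-id (upTo b))
upTo-+ (suc a) b = cong (0 ∷_) (begin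
  applyUpTo suc (a + b)                             ≡⟨ map-upTo suc (a + b) ⟨
  map suc (upTo (a + b))                            ≡⟨ cong (map suc) (upTo-+ a b) ⟩
  map suc (upTo a ++ map (a +_) (upTo b))           ≡⟨ map-++ suc (upTo a) _ ⟩
  map suc (upTo a) ++ map suc (map (a +_) (upTo b)) ≡⟨ cong₂ _++_ (map-upTo suc a) (sym (map-∘ (upTo b))) ⟩
  applyUpTo suc a ++ map (suc a +_) (upTo b)        ∎)
  where open ≡-Reasoning

upTo-* : ∀ n m → concatMap (λ r → map (n * r +_) (upTo n)) (upTo m) ≡ upTo (n * m)
upTo-* n zero    = cong upTo (sym (*-zeroʳ n))
upTo-* n (suc m) = begin
  concatMap block (upTo (suc m))                   ≡⟨ cong (concatMap block) (upTo-∷ʳ m) ⟨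
  concatMap block (upTo m ++ [ m ])                ≡⟨ concatMap-++ block (upTo m) [ m ] ⟩
  concatMap block (upTo m) ++ block m ++ []         ≡⟨ cong₂ _++_ (upTo-* n m) (++-identityʳ (block m)) ⟩
  upTo (n * m) ++ map (n * m +_) (upTo n)          ≡⟨ upTo-+ (n * m) n ⟨
  upTo (n * m + n)                                 ≡⟨ cong upTo (trans (+-comm (n * m) n) (sym (*-suc n m))) ⟩
  upTo (n * suc m)                                 ∎
  where
  open ≡-Reasoning
  block : ℕ → List ℕ
  block r = map (n * r +_) (upTo n)

map-mod-upTo : ∀ k → map (_mod k) (upTo k) ≡ upTo k
map-mod-upTo k = map-id-local (tabulate (mod-small ∘ ∈-upTo⁻))

coset-complete : ∀ n m → concatMap (coset n m) (upTo n) ↭ upTo (n * m)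
coset-complete n m = begin
  concatMap (coset n m) (upTo n)
    ↭⟨ concatMap-map-transpose (flip (fromDigits n m)) (upTo n) (upTo m) ⟩
  concatMap (λ r → map (fromDigits n m r) (upTo n)) (upTo m)
    ≡⟨ concatMap-cong (λ r → map-∘ (upTo n)) (upTo m) ⟩
  concatMap (λ r → map (_mod (n * m)) (map (n * r +_) (upTo n))) (upTo m)
    ≡⟨ map-concatMap (_mod (n * m)) (λ r → map (n * r +_) (upTo n)) (upTo m) ⟨
  map (_mod (n * m)) (concatMap (λ r → map (n * r +_) (upTo n)) (upTo m))
    ≡⟨ cong (map (_mod (n * m))) (upTo-* n m) ⟩
  map (_mod (n * m)) (upTo (n * m))
    ≡⟨ map-mod-upTo (n * m) ⟩
  upTo (n * m) ∎
  where open PermutationReasoning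

fromDigits-zero : ∀ n′ m′ → fromDigits (suc n′) (suc m′) 0 0 ≡ 0
fromDigits-zero n′ m′ = cong (λ a → (a + 0) mod (suc n′ * suc m′)) (*-zeroʳ (suc n′))

upTo-suc : ∀ k → upTo (suc k) ≡ 0 ∷ Zstar (suc k)
upTo-suc k = cong (0 ∷_) (sym (map-upTo suc k))

coset-Zstar : ∀ n′ m′ → let n = suc n′; m = suc m′ in
  concatMap (coset n m) (Zstar n) ++ map (flip (fromDigits n m) 0) (Zstar m) ↭ Zstar (n * m)
coset-Zstar n′ m′ = drop-∷ (begin
  0 ∷ (cosets (Zstar n) ++ map nr (Zstar m))
    ↭⟨ ↭-prep 0 (++-comm (cosets (Zstar n)) _) ⟩
  0 ∷ map nr (Zstar m) ++ cosets (Zstar n)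
    ≡⟨ cong (λ z → z ∷ map nr (Zstar m) ++ cosets (Zstar n)) (fromDigits-zero n′ m′) ⟨
  map nr (0 ∷ Zstar m) ++ cosets (Zstar n)
    ≡⟨ cong (λ zs → map nr zs ++ cosets (Zstar n)) (upTo-suc m′) ⟨
  cosets (0 ∷ Zstar n)
    ≡⟨ cong cosets (upTo-suc n′) ⟨
  cosets (upTo n)
    ↭⟨ coset-complete n m ⟩
  upTo (n * m)
    ≡⟨ upTo-suc (m′ + n′ * m) ⟩
  0 ∷ Zstar (n * m) ∎)
  where
  open PermutationReasoning
  n m : ℕ
  n = suc n′
  m = suc m′
  nr : ℕ → ℕ
  nr = flip (fromDigits n m) 0
  cosets : List ℕ → List ℕ
  cosets = concatMap (coset n m)

∈-Zstar⁻ : ∀ {k x} → x ∈ Zstar (suc k) → x < suc k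
∈-Zstar⁻ x∈ with ∈-map⁻ suc x∈
... | _ , y∈ , refl = s≤s (∈-upTo⁻ y∈)

neg-involutive : ∀ {k r} → r < suc k → neg (suc k) (neg (suc k) r) ≡ r
neg-involutive {k} {zero}   _ = trans (cong (neg (suc k)) (n%n≡0 (suc k))) (n%n≡0 (suc k))
neg-involutive {k} {suc r} (s≤s r<k) = begin
  neg (suc k) ((k ∸ r) % suc k)   ≡⟨ cong (neg (suc k)) (m<n⇒m%n≡m (s≤s (m∸n≤m k r))) ⟩
  (suc k ∸ (k ∸ r)) % suc k       ≡⟨ cong (_% suc k) (+-∸-assoc 1 (m∸n≤m k r)) ⟩
  suc (k ∸ (k ∸ r)) % suc k       ≡⟨ cong (λ a → suc a % suc k) (m∸[m∸n]≡n (<⇒≤ r<k)) ⟩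
  suc r % suc k                   ≡⟨ m<n⇒m%n≡m (s≤s r<k) ⟩
  suc r                           ∎
  where open ≡-Reasoning

seconds↭neg-firsts : ∀ {m T̄} → Is2Partition m T̄ → GoodOrder m T̄ → seconds T̄ ↭ map (neg m) (firsts T̄)
seconds↭neg-firsts {T̄ = T̄} T̄-part good =
  ↭-cancelˡ (firsts T̄) (↭-trans (↭-sym (entries-unzip T̄)) (↭-trans T̄-part (↭-sym good)))

GoodOrder-seconds : ∀ {k} T̄ → Is2Partition (suc k) T̄ → GoodOrder (suc k) T̄ →
  seconds T̄ ++ map (neg (suc k)) (seconds T̄) ↭ Zstar (suc k)
GoodOrder-seconds {k} T̄ T̄-part good = begin
  seconds T̄ ++ map ν (seconds T̄) ↭⟨ ++⁺ S↭νF (map⁺ ν S↭νF) ⟩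
  map ν F ++ map ν (map ν F)      ≡⟨ cong (map ν F ++_) νν ⟩
  map ν F ++ F                    ↭⟨ ++-comm (map ν F) F ⟩
  F ++ map ν F                    ↭⟨ good ⟩
  Zstar (suc k)                   ∎
  where
  open PermutationReasoning
  ν : ℕ → ℕ
  ν = neg (suc k)
  F : List ℕ
  F = firsts T̄
  S↭νF : seconds T̄ ↭ map ν F
  S↭νF = seconds↭neg-firsts T̄-part good
  νν : map ν (map ν F) ≡ F
  νν = trans (sym (map-∘ F))
    (map-id-local (tabulate (λ r∈F → neg-involutive (∈-Zstar⁻ (∈-resp-↭ good (∈-++⁺ˡ r∈F))))))

signedPairs : ℕ → List (ℕ × ℕ) → List (ℕ × ℕ)
signedPairs m T̄ = T̄ ++ negPairs m T̄ ++ [ (0 , 0) ]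

signedPairs-coordinate : ∀ {k} (f : ℕ × ℕ → ℕ) →
  (∀ r t → f (neg (suc k) r , neg (suc k) t) ≡ neg (suc k) (f (r , t))) → f (0 , 0) ≡ 0 →
  ∀ T̄ → map f T̄ ++ map (neg (suc k)) (map f T̄) ↭ Zstar (suc k) →
  map f (signedPairs (suc k) T̄) ↭ upTo (suc k)
signedPairs-coordinate {k} f f-neg f-0 T̄ complete = begin
  map f (T̄ ++ negPairs m T̄ ++ [ (0 , 0) ])       ≡⟨ map-++ f T̄ _ ⟩
  map f T̄ ++ map f (negPairs m T̄ ++ [ (0 , 0) ])  ≡⟨ cong (map f T̄ ++_) (map-++ f (negPairs m T̄) _) ⟩
  map f T̄ ++ map f (negPairs m T̄) ++ [ f (0 , 0) ] ≡⟨ cong₂ (λ zs z → map f T̄ ++ zs ++ [ z ]) negate f-0 ⟩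
  map f T̄ ++ map (neg m) (map f T̄) ++ [ 0 ]        ≡⟨ ++-assoc (map f T̄) _ _ ⟨
  (map f T̄ ++ map (neg m) (map f T̄)) ++ [ 0 ]      ↭⟨ ++-comm _ [ 0 ] ⟩
  0 ∷ map f T̄ ++ map (neg m) (map f T̄)             ↭⟨ ↭-prep 0 complete ⟩
  0 ∷ Zstar m                                        ≡⟨ upTo-suc k ⟨
  upTo m                                             ∎
  where
  open PermutationReasoning
  m : ℕ
  m = suc k
  negate : map f (negPairs m T̄) ≡ map (neg m) (map f T̄)
  negate = trans (sym (map-∘ T̄)) (trans (map-cong (λ (r , t) → f-neg r t) T̄) (map-∘ T̄))

theorem2p8 : (n m : ℕ) → 3 ≤ n → 3 ≤ m → n % 2 ≡ 1 → m % 2 ≡ 1 →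
    (S T : List (ℕ × ℕ)) → Is2Partition n S → Is2Partition m T →
    (Stilde Tbar : List (ℕ × ℕ)) → Reorders S Stilde → Reorders T Tbar →
    GoodOrder m Tbar →
    Is2Partition (n * m) (product n m Stilde Tbar)
theorem2p8 (suc n′) (suc m′) _ _ _ _ S T S-part T-part S̃ T̄ S~S̃ T~T̄ good = begin
  entries (typeI ++ typeII)                               ≡⟨ concatMap-++ _ typeI typeII ⟩
  entries typeI ++ entries typeII                         ↭⟨ ++⁺ typeI-entries typeII-entries ⟩
  concatMap (coset n m) (Zstar n) ++ map nr (Zstar m)     ↭⟨ coset-Zstar n′ m′ ⟩
  Zstar (n * m)                                           ∎
  where
  open PermutationReasoning
  n m : ℕ
  n = suc n′
  m = suc m′
  nr : ℕ → ℕ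
  nr = flip (fromDigits n m) 0
  S̃-part : Is2Partition n S̃
  S̃-part = Is2Partition-reorder {n} S-part S~S̃
  T̄-part : Is2Partition m T̄
  T̄-part = Is2Partition-reorder {m} T-part T~T̄
  typeI typeII : List (ℕ × ℕ)
  typeI  = cartesianProductWith (prodPair n m) (signedPairs m T̄) S̃
  typeII = map (λ rt → prodPair n m rt (0 , 0)) T̄
  typeI-entries : entries typeI ↭ concatMap (coset n m) (Zstar n)
  typeI-entries = ↭-trans
    (entries-cartesianProductWith-zip′ (fromDigits n m) (signedPairs m T̄) S̃
      (signedPairs-coordinate proj₁ (λ _ _ → refl) refl T̄ good)
      (signedPairs-coordinate proj₂ (λ _ _ → refl) refl T̄ (GoodOrder-seconds T̄ T̄-part good)))
    (concatMap⁺ (coset n m) S̃-part)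
  typeII-entries : entries typeII ↭ map nr (Zstar m)
  typeII-entries = ↭-trans (↭-reflexive (entries-map-×-diag nr T̄)) (map⁺ nr T̄-part)
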